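{- Let $N$ be a network, let $P$ be a cherry cover of $B(N)$, and let $uv$ be an edge of $B(N)$ that is covered by at least two shapes in $P$. Then $u$ is a multifurcation.
   Context: A (phylogenetic) network $N$ on a finite set $X$ is a directed acyclic graph with a unique vertex of indegree $0$ and outdegree $1$ (the root), vertices of indegree $1$ and outdegree $0$ (the leaves) bijectively labelled by $X$, and in which every other vertex has either indegree $1$ (a tree vertex) or outdegree $1$ (a reticulation), but not both. The edge leaving the root is the root edge. A tree vertex is a bifurcation if it has outdegree $2$ and a multifurcation if it has outdegree at least $3$. The bulged version $B(N)$ is the multigraph obtained from $N$ by replacing the outgoing edge of each reticulation of indegree $k$ by $k-1$ parallel edges; in $B(N)$ a reticulation is a vertex of indegree at least $2$ and outdegree at least $1$. A cherry shape is a subgraph of $B(N)$ on three distinct vertices $x,y,p$ with edges $px$ and $py$. A reticulated cherry shape is a subgraph of $B(N)$ on four vertices $x,y,p_x,p_y$ with edges $p_xx$, $p_yp_x$, $p_yy$, where $p_x$ is a reticulation; $p_yp_x$ is its middle edge. An edge is covered by a shape if it is one of its edges. A cherry cover of $B(N)$ is a set $P$ of cherry shapes and reticulated cherry shapes such that: (i) every edge other than the root edge is covered by at least one shape in $P$; (ii) every outgoing edge of a reticulation is covered by exactly one shape in $P$; (iii) every edge that is the middle edge of some reticulated cherry shape in $P$ is covered by exactly one shape in $P$. -}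

module Defs where

open import Data.Nat using (ℕ; zero; suc; _+_; _∸_; _≤_; _≤ᵇ_; _≡ᵇ_)
open import Data.Fin using (Fin; _≟_)
open import Data.List using (List; map; allFin)
open import Data.Nat.ListAction using (sum)
open import Data.Empty using (⊥)
open import Data.Bool using (Bool; true; false; if_then_else_; _∧_)
open import Data.Product using (Σ; Σ-syntax; ∃; ∃-syntax; _×_; _,_; proj₁; proj₂)
open import Data.Sum using (_⊎_)
open import Relation.Nullary using (¬_; does)
open import Relation.Binary.PropositionalEquality using (_≡_; _≢_)
open import Function.Bundles using (_⇔_)

record Graph : Set where
  field
    n   : ℕ
    m   : ℕ
    src : Fin m → Fin n
    tgt : Fin m → Fin n

module _ (G : Graph) where
  open Graph G

  indeg : Fin n → ℕ
  indeg v = sum (map (λ e → if does (tgt e ≟ v) then 1 else 0) (allFin m))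

  outdeg : Fin n → ℕ
  outdeg v = sum (map (λ e → if does (src e ≟ v) then 1 else 0) (allFin m))

  data Path⁺ : Fin n → Fin n → Set where
    one  : (e : Fin m) → Path⁺ (src e) (tgt e)
    cons : (e : Fin m) {w : Fin n} → Path⁺ (tgt e) w → Path⁺ (src e) w

  -- A (phylogenetic) network.  The leaf labelling by X is a bijection
  -- from X onto the leaves and plays no role, so it is not recorded.
  record IsNetwork : Set where
    field
      acyclic     : ∀ v → ¬ Path⁺ v v
      noParallel  : ∀ e e′ → src e ≡ src e′ → tgt e ≡ tgt e′ → e ≡ e′
      root        : Fin n
      root-indeg  : indeg root ≡ 0
      root-outdeg : outdeg root ≡ 1
      root-unique : ∀ v → indeg v ≡ 0 → v ≡ root
      -- every non-root vertex is a leaf (indeg 1, outdeg 0), a tree vertex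
      -- (indeg 1) or a reticulation (outdeg 1), not both indeg 1 and outdeg 1
      others      : ∀ v → v ≢ root →
                      (indeg v ≡ 1 × outdeg v ≢ 1) ⊎ (outdeg v ≡ 1 × indeg v ≢ 1)

  -- reticulation of N (in a network: non-root, outdeg 1, hence indeg ≥ 2)
  isRetN : Fin n → Bool
  isRetN v = (2 ≤ᵇ indeg v) ∧ (outdeg v ≡ᵇ 1)

  -- tree vertex with outdegree ≥ 3 (indeg 1 excludes the root;
  -- outdeg ≥ 3 excludes leaves)
  Multifurcation : Fin n → Set
  Multifurcation v = indeg v ≡ 1 × 3 ≤ outdeg v

  -- The bulged version B(N): the outgoing edge of a reticulation of
  -- indegree k is replaced by k-1 parallel copies; all other edges kept.

  mult : Fin m → ℕ
  mult e = if isRetN (src e) then indeg (src e) ∸ 1 else 1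

  BEdge : Set
  BEdge = Σ (Fin m) (λ e → Fin (mult e))

  srcB : BEdge → Fin n
  srcB (e , _) = src e

  tgtB : BEdge → Fin n
  tgtB (e , _) = tgt e

  indegB : Fin n → ℕ
  indegB v = sum (map (λ e → if does (tgt e ≟ v) then mult e else 0) (allFin m))

  outdegB : Fin n → ℕ
  outdegB v = sum (map (λ e → if does (src e ≟ v) then mult e else 0) (allFin m))

  RetB : Fin n → Set
  RetB v = 2 ≤ indegB v × 1 ≤ outdegB v

  record CherryShape : Set where
    field
      ex ey : BEdge
      samePar : srcB ex ≡ srcB ey
      x≢y : tgtB ex ≢ tgtB ey
      p≢x : srcB ex ≢ tgtB ex
      p≢y : srcB ey ≢ tgtB ey

  -- reticulated cherry shape: edges p_x x, p_y p_x (middle), p_y y,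
  -- on four distinct vertices, p_x a reticulation of B(N)
  record RetCherryShape : Set where
    field
      ex emid ey : BEdge
      pxLink : srcB ex ≡ tgtB emid
      pyLink : srcB emid ≡ srcB ey
      x≢y   : tgtB ex ≢ tgtB ey
      x≢px  : tgtB ex ≢ srcB ex
      x≢py  : tgtB ex ≢ srcB ey
      y≢px  : tgtB ey ≢ srcB ex
      y≢py  : tgtB ey ≢ srcB ey
      px≢py : srcB ex ≢ srcB ey
      pxRet : RetB (srcB ex)

  data Shape : Set where
    cherry    : CherryShape → Shape
    retCherry : RetCherryShape → Shape

  Covers : Shape → BEdge → Set
  Covers (cherry c) f = f ≡ CherryShape.ex c ⊎ f ≡ CherryShape.ey c
  Covers (retCherry r) f =
    f ≡ RetCherryShape.ex r ⊎ (f ≡ RetCherryShape.emid r ⊎ f ≡ RetCherryShape.ey r)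

  MiddleEdge : Shape → BEdge → Set
  MiddleEdge (cherry _)    f = ⊥
  MiddleEdge (retCherry r) f = f ≡ RetCherryShape.emid r

  -- two shapes are the same subgraph iff they have the same edge set
  -- (every vertex of a shape is an endpoint of one of its edges)
  SameShape : Shape → Shape → Set
  SameShape S S′ = ∀ f → Covers S f ⇔ Covers S′ f

  module _ (P : Shape → Set) where
    CoveredAtLeastOnce : BEdge → Set
    CoveredAtLeastOnce f = ∃[ S ] (P S × Covers S f)

    CoveredExactlyOnce : BEdge → Set
    CoveredExactlyOnce f =
      CoveredAtLeastOnce f ×
      (∀ S S′ → P S → P S′ → Covers S f → Covers S′ f → SameShape S S′)

    CoveredAtLeastTwice : BEdge → Set
    CoveredAtLeastTwice f =
      Σ[ S ∈ Shape ] Σ[ S′ ∈ Shape ]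
        (P S × P S′ × Covers S f × Covers S′ f × ¬ SameShape S S′)

  record IsCherryCover (N : IsNetwork) (P : Shape → Set) : Set where
    field
      coverAll   : ∀ f → srcB f ≢ IsNetwork.root N → CoveredAtLeastOnce P f
      -- (ii) outgoing edges of reticulations covered exactly once
      coverRet   : ∀ f → RetB (srcB f) → CoveredExactlyOnce P f
      -- (iii) middle edges covered exactly once
      coverMid   : ∀ S f → P S → MiddleEdge S f → CoveredExactlyOnce P f

-- Let f = uv be covered by two different shapes S, S′ of a cherry cover P.
-- Condition (ii) rules out that f leaves a reticulation and condition (iii)
-- that f is a middle edge, since then f would be covered exactly once.  In
-- the remaining cases f has a *partner* g in S: an edge with the same tail u
-- and a different head, such that either S is the cherry shape {f, g} or g is
-- the middle edge of S.  Hence u has two children, so it is neither the root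
-- nor a reticulation (both have outdegree 1): u is a tree vertex, and B(N)
-- does not duplicate its outgoing edges.  If u had only two children, the
-- partners of f in S and in S′ would coincide, and a common partner forces
-- S = S′ (either both shapes are {f, g}, or g is a middle edge and hence is
-- covered exactly once by (iii)).  So u has at least three children.
module Submission where

open import Defs
open import Data.Nat using (ℕ; zero; suc; _≤_; s≤s; z≤n; _≤ᵇ_) renaming (_≟_ to _≟ℕ_)
open import Data.Nat.Properties using (≤-trans; >⇒≢)
open import Data.Fin using (Fin; _≟_; zero; suc)
open import Data.Fin.Subset using (Subset; _∈_; _-_; ∣_∣)
open import Data.Fin.Subset.Properties using (x∈p⇒∣p-x∣<∣p∣; x∈p∧x≢y⇒x∈p-y)
open import Data.List using (tabulate)
open import Data.List.Properties using (map-tabulate)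
open import Data.Nat.ListAction using (sum)
open import Data.Vec as Vec using ()
open import Data.Vec.Properties using (lookup∘tabulate; lookup⇒[]=)
open import Data.Bool using (Bool; true; false; if_then_else_)
open import Data.Bool.Properties using (∧-zeroʳ)
open import Data.Empty using (⊥-elim)
open import Data.Product using (Σ-syntax; _×_; _,_; proj₁; proj₂)
open import Data.Sum using (_⊎_; inj₁; inj₂; swap)
open import Function.Bundles using (_⇔_; mk⇔)
import Function.Properties.Equivalence as ⇔
open import Relation.Nullary using (does; yes; no)
open import Relation.Nullary.Decidable using (dec-true; dec-false)
open import Relation.Binary.PropositionalEquality
  using (_≡_; _≢_; refl; sym; trans; cong; subst; ≢-sym)

∈⇒1≤∣∣ : ∀ {k} {p : Subset k} {x} → x ∈ p → 1 ≤ ∣ p ∣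
∈⇒1≤∣∣ x∈p = ≤-trans (s≤s z≤n) (x∈p⇒∣p-x∣<∣p∣ x∈p)

∈₂⇒2≤∣∣ : ∀ {k} {p : Subset k} {x y} → x ∈ p → y ∈ p → y ≢ x → 2 ≤ ∣ p ∣
∈₂⇒2≤∣∣ x∈p y∈p y≢x =
  ≤-trans (s≤s (∈⇒1≤∣∣ (x∈p∧x≢y⇒x∈p-y y∈p y≢x))) (x∈p⇒∣p-x∣<∣p∣ x∈p)

∈₃⇒3≤∣∣ : ∀ {k} {p : Subset k} {x y z} → x ∈ p → y ∈ p → z ∈ p →
          y ≢ x → z ≢ x → z ≢ y → 3 ≤ ∣ p ∣
∈₃⇒3≤∣∣ x∈p y∈p z∈p y≢x z≢x z≢y =
  ≤-trans (s≤s (∈₂⇒2≤∣∣ (x∈p∧x≢y⇒x∈p-y y∈p y≢x) (x∈p∧x≢y⇒x∈p-y z∈p z≢x) z≢y))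
          (x∈p⇒∣p-x∣<∣p∣ x∈p)

toSubset : ∀ {k} → (Fin k → Bool) → Subset k
toSubset = Vec.tabulate

∈-toSubset : ∀ {k} (b : Fin k → Bool) {i} → b i ≡ true → i ∈ toSubset b
∈-toSubset b {i} bi = lookup⇒[]= i (toSubset b) (trans (lookup∘tabulate b i) bi)

indicatorSum : ∀ k (b : Fin k → Bool) →
               sum (tabulate (λ i → if b i then 1 else 0)) ≡ ∣ toSubset b ∣
indicatorSum zero    b = refl
indicatorSum (suc k) b with b zero
... | true  = cong suc (indicatorSum k (λ i → b (suc i)))
... | false = indicatorSum k (λ i → b (suc i))

module _ (G : Graph) where
  open Graph G

  outEdges : Fin n → Subset m
  outEdges v = toSubset (λ e → does (src e ≟ v))

  outdeg≡∣outEdges∣ : ∀ v → outdeg G v ≡ ∣ outEdges v ∣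
  outdeg≡∣outEdges∣ v = trans (cong sum (map-tabulate (λ e → e) indicator)) (indicatorSum m isOut)
    where
    isOut : Fin m → Bool
    isOut e = does (src e ≟ v)
    indicator : Fin m → ℕ
    indicator e = if isOut e then 1 else 0

  ∈-outEdges : ∀ {v} e → src e ≡ v → e ∈ outEdges v
  ∈-outEdges {v} e eq = ∈-toSubset (λ e → does (src e ≟ v)) (dec-true (src e ≟ v) eq)

  2≤outdeg : ∀ {v} e e′ → src e ≡ v → src e′ ≡ v → e′ ≢ e → 2 ≤ outdeg G v
  2≤outdeg {v} e e′ se se′ e′≢e =
    subst (2 ≤_) (sym (outdeg≡∣outEdges∣ v)) (∈₂⇒2≤∣∣ (∈-outEdges e se) (∈-outEdges e′ se′) e′≢e)

  3≤outdeg : ∀ {v} e e′ e″ → src e ≡ v → src e′ ≡ v → src e″ ≡ v →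
             e′ ≢ e → e″ ≢ e → e″ ≢ e′ → 3 ≤ outdeg G v
  3≤outdeg {v} e e′ e″ se se′ se″ e′≢e e″≢e e″≢e′ =
    subst (3 ≤_) (sym (outdeg≡∣outEdges∣ v))
      (∈₃⇒3≤∣∣ (∈-outEdges e se) (∈-outEdges e′ se′) (∈-outEdges e″ se″) e′≢e e″≢e e″≢e′)

  Sibling : BEdge G → BEdge G → Set
  Sibling g f = srcB G g ≡ srcB G f × tgtB G g ≢ tgtB G f

  -- B(N) only multiplies edges leaving reticulations, which have outdegree 1.
  mult≡1 : ∀ e → outdeg G (src e) ≢ 1 → mult G e ≡ 1
  mult≡1 e out≢1 rewrite dec-false (outdeg G (src e) ≟ℕ 1) out≢1
                       | ∧-zeroʳ (2 ≤ᵇ indeg G (src e)) = refl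

  bedge-≡ : (g h : BEdge G) → proj₁ g ≡ proj₁ h → outdeg G (srcB G g) ≢ 1 → g ≡ h
  bedge-≡ (e , i) (.e , j) refl out≢1 = cong (e ,_) (Fin1-≡ (mult≡1 e out≢1) i j)
    where
    Fin1-≡ : ∀ {k} → k ≡ 1 → (i j : Fin k) → i ≡ j
    Fin1-≡ refl zero zero = refl

  -- In a network, a vertex with at least two children is a tree vertex:
  -- the root and the reticulations have outdegree 1.
  branching⇒treeVertex : IsNetwork G → ∀ v → 2 ≤ outdeg G v →
                         indeg G v ≡ 1 × outdeg G v ≢ 1
  branching⇒treeVertex N v 2≤out with v ≟ IsNetwork.root N
  ... | yes refl = ⊥-elim (>⇒≢ 2≤out (IsNetwork.root-outdeg N))
  ... | no v≢root with IsNetwork.others N v v≢root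
  ...   | inj₁ treeVertex  = treeVertex
  ...   | inj₂ (out≡1 , _) = ⊥-elim (>⇒≢ 2≤out out≡1)

  -- An edge f with two different siblings leaves a multifurcation: its tail
  -- is a tree vertex, whose outgoing edges B(N) does not duplicate, so the
  -- underlying edges of f and its siblings are three distinct children.
  siblings⇒multifurcation : IsNetwork G → ∀ f g g′ → Sibling g f → Sibling g′ f →
                            g′ ≢ g → Multifurcation G (srcB G f)
  siblings⇒multifurcation N (e , _) (d , i) (d′ , i′) (d↑ , d≢) (d′↑ , d′≢) g′≢g =
    indeg≡1 , 3≤out
    where
    2≤out : 2 ≤ outdeg G (src e)
    2≤out = 2≤outdeg e d refl d↑ (λ d≡e → d≢ (cong tgt d≡e))
    indeg≡1 : indeg G (src e) ≡ 1
    indeg≡1 = proj₁ (branching⇒treeVertex N (src e) 2≤out)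
    out≢1 : outdeg G (src d′) ≢ 1
    out≢1 = subst (λ v → outdeg G v ≢ 1) (sym d′↑) (proj₂ (branching⇒treeVertex N (src e) 2≤out))
    3≤out : 3 ≤ outdeg G (src e)
    3≤out with d′ ≟ d
    ... | yes d′≡d = ⊥-elim (g′≢g (bedge-≡ (d′ , i′) (d , i) d′≡d out≢1))
    ... | no d′≢d  = 3≤outdeg e d d′ refl d↑ d′↑
                       (λ d≡e → d≢ (cong tgt d≡e)) (λ d′≡e → d′≢ (cong tgt d′≡e)) d′≢d

module _ (G : Graph) where

  data PartnerRole (S : Shape G) (f g : BEdge G) : Set where
    cherryPair : (∀ h → Covers G S h ⇔ (h ≡ f ⊎ h ≡ g)) → PartnerRole S f g
    middleEdge : MiddleEdge G S g → PartnerRole S f g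

  record Partner (S : Shape G) (f : BEdge G) : Set where
    constructor partner
    field
      edge      : BEdge G
      sibling   : Sibling G edge f
      inShape   : Covers G S edge
      role      : PartnerRole S f edge

  module _ {N : IsNetwork G} {P : Shape G → Set} (C : IsCherryCover G N P) where
    open IsCherryCover C

    -- An edge covered by a shape of the cover is covered exactly once
    -- (it leaves a reticulation or is a middle edge), or has a partner.
    exactlyOnce-or-partner : ∀ S f → P S → Covers G S f →
                             CoveredExactlyOnce G P f ⊎ Partner S f
    exactlyOnce-or-partner (cherry c) f _ (inj₁ refl) =
      inj₂ (partner ey (sym samePar , ≢-sym x≢y) (inj₂ refl) (cherryPair (λ _ → ⇔.refl)))
      where open CherryShape c
    exactlyOnce-or-partner (cherry c) f _ (inj₂ refl) =
      inj₂ (partner ex (samePar , x≢y) (inj₁ refl) (cherryPair (λ _ → mk⇔ swap swap)))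
      where open CherryShape c
    exactlyOnce-or-partner (retCherry r) f _ (inj₁ refl) = inj₁ (coverRet ex pxRet)
      where open RetCherryShape r
    exactlyOnce-or-partner (retCherry r) f PS (inj₂ (inj₁ refl)) =
      inj₁ (coverMid (retCherry r) emid PS refl)
      where open RetCherryShape r
    exactlyOnce-or-partner (retCherry r) f _ (inj₂ (inj₂ refl)) =
      inj₂ (partner emid (pyLink , λ e → y≢px (sym (trans pxLink e)))
                    (inj₂ (inj₁ refl)) (middleEdge refl))
      where open RetCherryShape r

    sharedPartner⇒sameShape : ∀ {S S′ f g} → P S → P S′ →
      Covers G S g → Covers G S′ g → PartnerRole S f g → PartnerRole S′ f g →
      SameShape G S S′
    sharedPartner⇒sameShape PS PS′ g∈S g∈S′ (middleEdge mid) _ =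
      proj₂ (coverMid _ _ PS mid) _ _ PS PS′ g∈S g∈S′
    sharedPartner⇒sameShape PS PS′ g∈S g∈S′ (cherryPair _) (middleEdge mid) =
      proj₂ (coverMid _ _ PS′ mid) _ _ PS PS′ g∈S g∈S′
    sharedPartner⇒sameShape _ _ _ _ (cherryPair S≡fg) (cherryPair S′≡fg) h =
      ⇔.trans (S≡fg h) (⇔.sym (S′≡fg h))

    -- An edge covered by two different shapes has two different siblings:
    -- its partners in the two shapes, which cannot coincide.
    twice⇒twoSiblings : ∀ f → CoveredAtLeastTwice G P f →
                        Σ[ g ∈ BEdge G ] Σ[ g′ ∈ BEdge G ]
                          (Sibling G g f × Sibling G g′ f × g′ ≢ g)
    twice⇒twoSiblings f (S , S′ , PS , PS′ , f∈S , f∈S′ , S≉S′)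
      with exactlyOnce-or-partner S f PS f∈S | exactlyOnce-or-partner S′ f PS′ f∈S′
    ... | inj₁ (_ , once) | _ = ⊥-elim (S≉S′ (once S S′ PS PS′ f∈S f∈S′))
    ... | inj₂ _ | inj₁ (_ , once) = ⊥-elim (S≉S′ (once S S′ PS PS′ f∈S f∈S′))
    ... | inj₂ (partner g sib g∈S role) | inj₂ (partner g′ sib′ g′∈S′ role′) =
      g , g′ , sib , sib′ , g′≢g
      where
      g′≢g : g′ ≢ g
      g′≢g refl = S≉S′ (sharedPartner⇒sameShape PS PS′ g∈S g′∈S′ role role′)

mainTheorem5 : (G : Graph) (N : IsNetwork G) (P : Shape G → Set) →
    IsCherryCover G N P →
    (f : BEdge G) → CoveredAtLeastTwice G P f →
    Multifurcation G (srcB G f)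
mainTheorem5 G N P C f twice with twice⇒twoSiblings G C f twice
... | g , g′ , sib , sib′ , g′≢g = siblings⇒multifurcation G N f g g′ sib sib′ g′≢g
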